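{- Let $k\in\mathbb{Z}$ and $n,m\in\mathbb{Z}^+$ with $k\not\equiv0\pmod n$. Then $\chi_{n,k}(P_2)=\chi_{n,k}(P_3)=2$, and $\chi_{n,k}(P_m)=3$ for all $m\ge4$.
   Context: $P_m$ is the path on $m$ vertices. For a graph $G=(V,E)$, a labeling $\ell:V\to\mathbb{Z}$ is proper if adjacent vertices get distinct labels, its order is the size of its image, and it is a closed coloring with remainder $k\bmod n$ if $\sum_{w\in N[v]}\ell(w)\equiv k\pmod n$ for every $v$, where $N[v]$ is the closed neighborhood of $v$. $\chi_{n,k}(G)$ is the minimum order of a proper closed coloring with remainder $k\bmod n$ (it does not exist if there is none). -}

module Defs where

open import Data.Nat using (ℕ; suc; _≤_)
open import Data.Fin using (Fin; toℕ)
open import Data.Integer using (ℤ; +_; _-_) renaming (_+_ to _+ℤ_)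
import Data.Integer as ℤ
open import Data.Integer.Divisibility using (_∣_)
open import Data.List using (List; []; _∷_; length; map; filter; deduplicate; allFin)
open import Data.Product using (Σ; _×_)
open import Data.Sum using (_⊎_)
open import Relation.Nullary using (¬_)
open import Relation.Nullary.Decidable using (_⊎-dec_)
open import Relation.Binary.PropositionalEquality using (_≡_; _≢_)
import Data.Nat as ℕ
import Data.Fin as Fin

PAdj : {m : ℕ} → Fin m → Fin m → Set
PAdj i j = (toℕ j ≡ suc (toℕ i)) ⊎ (toℕ i ≡ suc (toℕ j))

PAdj? : {m : ℕ} → (i j : Fin m) → Relation.Nullary.Dec (PAdj i j)
PAdj? i j = (toℕ j ℕ.≟ suc (toℕ i)) ⊎-dec (toℕ i ℕ.≟ suc (toℕ j))

closedNbhd : (m : ℕ) → Fin m → List (Fin m)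
closedNbhd m v = filter (λ w → (w Fin.≟ v) ⊎-dec PAdj? v w) (allFin m)

Labeling : ℕ → Set
Labeling m = Fin m → ℤ

Proper : (m : ℕ) → Labeling m → Set
Proper m ℓ = ∀ (v w : Fin m) → PAdj v w → ℓ v ≢ ℓ w

_≡_[mod_] : ℤ → ℤ → ℕ → Set
a ≡ b [mod n ] = (+ n) ∣ (a - b)

sumℤ : List ℤ → ℤ
sumℤ [] = + 0
sumℤ (x ∷ xs) = x +ℤ sumℤ xs

ClosedColoring : (m : ℕ) → ℕ → ℤ → Labeling m → Set
ClosedColoring m n k ℓ = ∀ (v : Fin m) → sumℤ (map ℓ (closedNbhd m v)) ≡ k [mod n ]

order : (m : ℕ) → Labeling m → ℕ
order m ℓ = length (deduplicate ℤ._≟_ (map ℓ (allFin m)))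

-- χ_{n,k}(P_m) = c : c is the minimum order of a proper closed coloring
-- with remainder k mod n (in particular such a coloring exists).
χPath≡ : (n : ℕ) → (k : ℤ) → (m : ℕ) → ℕ → Set
χPath≡ n k m c =
  Σ (Labeling m) (λ ℓ → Proper m ℓ × ClosedColoring m n k ℓ × order m ℓ ≡ c)
  × (∀ (ℓ : Labeling m) → Proper m ℓ → ClosedColoring m n k ℓ → c ≤ order m ℓ)

-- A proper 2-labelling of P_m with m ≥ 4 starts a, b, a, b, so a + b, 2a + b and a + 2b
-- are all ≡ k (mod n); then k ≡ (2a + b - k) + (a + 2b - k) - 3 (a + b - k) ≡ 0, which is
-- excluded.  Three labels always suffice: repeat k, n, 0 (or n, k, 0 when 3 ∣ m, so that the
-- last vertex still sees a k); every closed neighbourhood then sums to k or k + n.  On P₂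
-- and P₃ the labellings k, n and 0, k, 0 use two labels.
module Submission where

open import Defs
open import Data.Nat using (ℕ; zero; suc; _+_; _≤_; z≤n; s≤s)
open import Data.Nat.Properties using (≤-antisym; suc-injective)
import Data.Nat.Divisibility as ℕ
open import Data.Fin using (Fin; zero; suc; toℕ; inject₁)
import Data.Fin as Fin
open import Data.Integer using (ℤ; +_; _-_) renaming (_+_ to _+ℤ_)
import Data.Integer as ℤ
open import Data.Integer.Properties using (+-identityˡ; +-identityʳ; +-comm; +-assoc; +-inverseʳ)
open import Data.Integer.Divisibility using (_∣_)
import Data.Integer.Divisibility.Signed as Signed
open import Data.Integer.Tactic.RingSolver using (solve-∀)
open import Data.List using (List; []; _∷_; length; map; filter; tabulate; allFin; deduplicate)
open import Data.List.Properties using (length-removeAt′; map-∘; map-tabulate; filter-none)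
open import Data.List.Relation.Unary.Any using (here; there)
open import Data.List.Relation.Unary.All using ([]; _∷_)
import Data.List.Relation.Unary.All as All
open import Data.List.Relation.Unary.All.Properties using (tabulate⁺)
open import Data.List.Relation.Unary.AllPairs using ([]; _∷_)
open import Data.List.Relation.Unary.Unique.Propositional using (Unique)
open import Data.List.Relation.Unary.Unique.DecPropositional.Properties ℤ._≟_ using (deduplicate-!)
open import Data.List.Membership.Propositional using (_∈_; _─_)
open import Data.List.Membership.Propositional.Properties
  using (∈-map⁺; ∈-map⁻; ∈-allFin; ∈-deduplicate⁺; ∈-deduplicate⁻)
open import Data.List.Relation.Binary.Subset.Propositional using (_⊆_)
open import Data.Product using (_,_; _×_)
open import Data.Sum using (_⊎_; inj₁; inj₂)
import Data.Sum as Sum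
open import Data.Bool using (true; false)
open import Data.Empty using (⊥-elim)
open import Function using (_∘_)
open import Relation.Nullary using (¬_; Dec; does; yes; no; _⊎-dec_)
open import Relation.Unary using (Pred; Decidable)
open import Relation.Binary.PropositionalEquality

module _ {A : Set} where

  ∈-─⁺ : ∀ {x y : A} {xs} (x∈xs : x ∈ xs) → y ∈ xs → y ≢ x → y ∈ xs ─ x∈xs
  ∈-─⁺ (here refl) (here refl) y≢x = ⊥-elim (y≢x refl)
  ∈-─⁺ (here refl) (there y∈xs) _   = y∈xs
  ∈-─⁺ (there _)   (here refl) _    = here refl
  ∈-─⁺ (there x∈xs) (there y∈xs) y≢x = there (∈-─⁺ x∈xs y∈xs y≢x)

  Unique⇒length≤ : ∀ {xs ys : List A} → Unique xs → xs ⊆ ys → length xs ≤ length ys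
  Unique⇒length≤ {[]}     _                 _   = z≤n
  Unique⇒length≤ {x ∷ xs} {ys} (x∉xs ∷ uxs) xs⊆ys =
    subst (suc (length xs) ≤_) (sym (length-removeAt′ ys _))
      (s≤s (Unique⇒length≤ uxs (λ y∈xs → ∈-─⁺ x∈ys (xs⊆ys (there y∈xs)) (≢x y∈xs))))
    where
    x∈ys = xs⊆ys (here refl)
    ≢x : ∀ {y} → y ∈ xs → y ≢ x
    ≢x y∈xs y≡x = All.lookup x∉xs y∈xs (sym y≡x)

label∈labels : ∀ {m} (ℓ : Labeling m) v → ℓ v ∈ map ℓ (allFin m)
label∈labels ℓ v = ∈-map⁺ ℓ (∈-allFin v)

Unique⇒length≤order : ∀ {m} (ℓ : Labeling m) {xs} → Unique xs → xs ⊆ map ℓ (allFin m) → length xs ≤ order m ℓ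
Unique⇒length≤order ℓ uxs xs⊆labels = Unique⇒length≤ uxs (∈-deduplicate⁺ ℤ._≟_ ∘ xs⊆labels)

order≤length : ∀ {m} (ℓ : Labeling m) {ys} → (∀ v → ℓ v ∈ ys) → order m ℓ ≤ length ys
order≤length {m} ℓ ℓ∈ys = Unique⇒length≤ (deduplicate-! (map ℓ (allFin m))) labels⊆ys
  where
  labels⊆ys : deduplicate ℤ._≟_ (map ℓ (allFin m)) ⊆ _
  labels⊆ys y∈labels with ∈-map⁻ ℓ (∈-deduplicate⁻ ℤ._≟_ (map ℓ (allFin m)) y∈labels)
  ... | v , _ , refl = ℓ∈ys v

≢⇒2≤order : ∀ {m} (ℓ : Labeling m) u v → ℓ u ≢ ℓ v → 2 ≤ order m ℓ
≢⇒2≤order ℓ u v ℓu≢ℓv = Unique⇒length≤order ℓ ((ℓu≢ℓv ∷ []) ∷ [] ∷ [])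
  λ { (here refl) → label∈labels ℓ u ; (there (here refl)) → label∈labels ℓ v }

≢⇒3≤order : ∀ {m} (ℓ : Labeling m) u v w → ℓ u ≢ ℓ v → ℓ v ≢ ℓ w → ℓ u ≢ ℓ w → 3 ≤ order m ℓ
≢⇒3≤order ℓ u v w ℓu≢ℓv ℓv≢ℓw ℓu≢ℓw =
  Unique⇒length≤order ℓ ((ℓu≢ℓv ∷ ℓu≢ℓw ∷ []) ∷ (ℓv≢ℓw ∷ []) ∷ [] ∷ [])
    λ { (here refl) → label∈labels ℓ u
      ; (there (here refl)) → label∈labels ℓ v
      ; (there (there (here refl))) → label∈labels ℓ w }

proper⇒2≤order : ∀ {m} (ℓ : Labeling (suc (suc m))) → Proper _ ℓ → 2 ≤ order _ ℓ
proper⇒2≤order ℓ proper = ≢⇒2≤order ℓ zero (suc zero) (proper zero (suc zero) (inj₁ refl))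

proper-closed⇒χ≡2 : ∀ {n k m} (ℓ : Labeling (2 + m)) {a b} → Proper _ ℓ → ClosedColoring _ n k ℓ →
                    (∀ v → ℓ v ∈ a ∷ b ∷ []) → χPath≡ n k (2 + m) 2
proper-closed⇒χ≡2 ℓ proper closed ℓ∈ab =
  (ℓ , proper , closed , ≤-antisym (order≤length ℓ ℓ∈ab) (proper⇒2≤order ℓ proper)) ,
  λ ℓ′ proper′ _ → proper⇒2≤order ℓ′ proper′

consecutive≢⇒adjacent≢ : ∀ {m} (ℓ : Labeling (suc m)) → (∀ v → ℓ (inject₁ v) ≢ ℓ (suc v)) →
                         ∀ v w → toℕ w ≡ suc (toℕ v) → ℓ v ≢ ℓ w
consecutive≢⇒adjacent≢ {suc m} ℓ h zero    (suc zero) _ = h zero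
consecutive≢⇒adjacent≢ {suc m} ℓ h (suc v) (suc w)    e =
  consecutive≢⇒adjacent≢ (ℓ ∘ suc) (h ∘ suc) v w (suc-injective e)

consecutive≢⇒proper : ∀ {m} (ℓ : Labeling (suc m)) → (∀ v → ℓ (inject₁ v) ≢ ℓ (suc v)) → Proper (suc m) ℓ
consecutive≢⇒proper ℓ h v w (inj₁ w≡v+1) = consecutive≢⇒adjacent≢ ℓ h v w w≡v+1
consecutive≢⇒proper ℓ h v w (inj₂ v≡w+1) = consecutive≢⇒adjacent≢ ℓ h w v v≡w+1 ∘ sym

filter-map : ∀ {A B : Set} {p q} {P : Pred A p} {Q : Pred B q} (P? : Decidable P) (Q? : Decidable Q) (f : B → A) →
             (∀ x → does (P? (f x)) ≡ does (Q? x)) → ∀ xs → filter P? (map f xs) ≡ map f (filter Q? xs)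
filter-map P? Q? f same [] = refl
filter-map P? Q? f same (x ∷ xs) with does (P? (f x)) | does (Q? x) | same x
... | true  | true  | refl = cong (f x ∷_) (filter-map P? Q? f same xs)
... | false | false | refl = filter-map P? Q? f same xs

inNbhd? : ∀ {m} (v w : Fin m) → Dec ((w ≡ v) ⊎ PAdj v w)
inNbhd? v w = (w Fin.≟ v) ⊎-dec PAdj? v w

closedNbhd-suc : ∀ m (v : Fin m) → filter (inNbhd? (suc v)) (tabulate suc) ≡ map suc (closedNbhd m v)
closedNbhd-suc m v = begin
  filter (inNbhd? (suc v)) (tabulate suc)          ≡⟨ cong (filter (inNbhd? (suc v))) (map-tabulate (λ w → w) suc) ⟨
  filter (inNbhd? (suc v)) (map suc (allFin m))    ≡⟨ filter-map (inNbhd? (suc v)) (inNbhd? v) suc (λ _ → refl) (allFin m) ⟩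
  map suc (closedNbhd m v)                         ∎
  where open ≡-Reasoning

secondLabel : ∀ {m} → Labeling (suc m) → ℤ
secondLabel {zero}  _ = + 0
secondLabel {suc _} ℓ = ℓ (suc zero)

-- nbhdSum p ℓ v is the closed-neighbourhood sum of v in the path labelled by ℓ and
-- extended on the left by one extra vertex labelled p; with p = 0 it is the sum in P_m.
nbhdSum : ∀ {m} → ℤ → Labeling m → Fin m → ℤ
nbhdSum p ℓ zero    = p +ℤ (ℓ zero +ℤ secondLabel ℓ)
nbhdSum p ℓ (suc v) = nbhdSum (ℓ zero) (ℓ ∘ suc) v

sumℤ-closedNbhd : ∀ m (ℓ : Labeling m) v → sumℤ (map ℓ (closedNbhd m v)) ≡ nbhdSum (+ 0) ℓ v
sumℤ-closedNbhd-suc : ∀ m (ℓ : Labeling (suc m)) v →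
                      sumℤ (map ℓ (filter (inNbhd? (suc v)) (tabulate suc))) ≡ nbhdSum (+ 0) (ℓ ∘ suc) v

sumℤ-closedNbhd (suc zero) ℓ zero = sym (+-identityˡ _)
sumℤ-closedNbhd (suc (suc m)) ℓ zero = begin
  ℓ zero +ℤ (ℓ (suc zero) +ℤ sumℤ (map ℓ (filter (inNbhd? zero) (tabulate {n = m} (λ w → suc (suc w))))))
    ≡⟨ cong (λ ws → ℓ zero +ℤ (ℓ (suc zero) +ℤ sumℤ (map ℓ ws))) (filter-none (inNbhd? zero) (tabulate⁺ far)) ⟩
  ℓ zero +ℤ (ℓ (suc zero) +ℤ + 0)
    ≡⟨ cong (ℓ zero +ℤ_) (+-identityʳ _) ⟩
  ℓ zero +ℤ ℓ (suc zero)
    ≡⟨ +-identityˡ _ ⟨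
  + 0 +ℤ (ℓ zero +ℤ ℓ (suc zero)) ∎
  where
  open ≡-Reasoning
  far : ∀ (w : Fin m) → ¬ ((suc (suc w) ≡ zero) ⊎ PAdj zero (suc (suc w)))
  far w (inj₁ ())
  far w (inj₂ (inj₁ ()))
  far w (inj₂ (inj₂ ()))
sumℤ-closedNbhd (suc (suc m)) ℓ (suc zero) = cong (ℓ zero +ℤ_) (begin
  sumℤ (map ℓ (filter (inNbhd? (suc zero)) (tabulate suc))) ≡⟨ sumℤ-closedNbhd-suc (suc m) ℓ zero ⟩
  nbhdSum (+ 0) (ℓ ∘ suc) zero                                ≡⟨ +-identityˡ _ ⟩
  ℓ (suc zero) +ℤ secondLabel (ℓ ∘ suc)                       ∎)
  where open ≡-Reasoning
sumℤ-closedNbhd (suc m) ℓ (suc (suc v)) = sumℤ-closedNbhd-suc m ℓ (suc v)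

sumℤ-closedNbhd-suc m ℓ v = begin
  sumℤ (map ℓ (filter (inNbhd? (suc v)) (tabulate suc))) ≡⟨ cong (sumℤ ∘ map ℓ) (closedNbhd-suc m v) ⟩
  sumℤ (map ℓ (map suc (closedNbhd m v)))                ≡⟨ cong sumℤ (map-∘ (closedNbhd m v)) ⟨
  sumℤ (map (ℓ ∘ suc) (closedNbhd m v))                  ≡⟨ sumℤ-closedNbhd m (ℓ ∘ suc) v ⟩
  nbhdSum (+ 0) (ℓ ∘ suc) v                              ∎
  where open ≡-Reasoning

≡⇒≡[mod] : ∀ {a b : ℤ} n → a ≡ b → a ≡ b [mod n ]
≡⇒≡[mod] {a} n refl = subst (+ n ∣_) (sym (+-inverseʳ a)) (n ℕ.∣0)

+n≡[mod] : ∀ (a : ℤ) n → (a +ℤ + n) ≡ a [mod n ]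
+n≡[mod] a n = subst (+ n ∣_) (sym (a+N-a≡N a (+ n))) ℕ.∣-refl
  where
  a+N-a≡N : ∀ a N → a +ℤ N - a ≡ N
  a+N-a≡N = solve-∀

ClosedPath : ℕ → ℤ → ∀ {m} → ℤ → Labeling m → Set
ClosedPath n k p ℓ = ∀ v → nbhdSum p ℓ v ≡ k [mod n ]

closedPath⇒closedColoring : ∀ {m n k} (ℓ : Labeling m) → ClosedPath n k (+ 0) ℓ → ClosedColoring m n k ℓ
closedPath⇒closedColoring {m} {n} {k} ℓ closed v =
  subst (λ s → s ≡ k [mod n ]) (sym (sumℤ-closedNbhd m ℓ v)) (closed v)

closedColoring⇒closedPath : ∀ {m n k} (ℓ : Labeling m) → ClosedColoring m n k ℓ → ClosedPath n k (+ 0) ℓ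
closedColoring⇒closedPath {m} {n} {k} ℓ closed v =
  subst (λ s → s ≡ k [mod n ]) (sumℤ-closedNbhd m ℓ v) (closed v)

alternating-not-closed : ∀ {n k} a b → ¬ (k ≡ + 0 [mod n ]) →
  (a +ℤ b) ≡ k [mod n ] → (a +ℤ (b +ℤ a)) ≡ k [mod n ] → ¬ ((b +ℤ (a +ℤ b)) ≡ k [mod n ])
alternating-not-closed {n} {k} a b k≢0 s₀ s₁ s₂ =
  k≢0 (∣⇒∣ᵤ (subst (Signed._∣_ (+ n)) (sym (k-as-combination a b k)) n∣combination))
  where
  open Signed using (∣ᵤ⇒∣; ∣⇒∣ᵤ; ∣m∣n⇒∣m+n; ∣m∣n⇒∣m-n)
  d₀ d₁ d₂ : ℤ
  d₀ = a +ℤ b - k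
  d₁ = a +ℤ (b +ℤ a) - k
  d₂ = b +ℤ (a +ℤ b) - k
  n∣d₀ : Signed._∣_ (+ n) d₀
  n∣d₀ = ∣ᵤ⇒∣ s₀
  n∣combination : Signed._∣_ (+ n) (d₁ +ℤ d₂ - (d₀ +ℤ (d₀ +ℤ d₀)))
  n∣combination = ∣m∣n⇒∣m-n (∣m∣n⇒∣m+n (∣ᵤ⇒∣ {i = d₁} s₁) (∣ᵤ⇒∣ {i = d₂} s₂))
                            (∣m∣n⇒∣m+n n∣d₀ (∣m∣n⇒∣m+n n∣d₀ n∣d₀))
  k-as-combination : ∀ a b k → k - + 0 ≡ (a +ℤ (b +ℤ a) - k) +ℤ (b +ℤ (a +ℤ b) - k)
                                         - ((a +ℤ b - k) +ℤ ((a +ℤ b - k) +ℤ (a +ℤ b - k)))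
  k-as-combination = solve-∀

pattern v₀ = zero
pattern v₁ = suc v₀
pattern v₂ = suc v₁
pattern v₃ = suc v₂

closedColoring⇒3≤order : ∀ {n k m} → ¬ (k ≡ + 0 [mod n ]) → (ℓ : Labeling (4 + m)) →
                         Proper _ ℓ → ClosedColoring _ n k ℓ → 3 ≤ order _ ℓ
closedColoring⇒3≤order {n} {k} k≢0 ℓ proper closed with ℓ v₀ ℤ.≟ ℓ v₂ | ℓ v₁ ℤ.≟ ℓ v₃
... | no ℓ₀≢ℓ₂ | _ = ≢⇒3≤order ℓ v₀ v₁ v₂ ℓ₀≢ℓ₁ ℓ₁≢ℓ₂ ℓ₀≢ℓ₂
  where
  ℓ₀≢ℓ₁ = proper v₀ v₁ (inj₁ refl)
  ℓ₁≢ℓ₂ = proper v₁ v₂ (inj₁ refl)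
... | yes ℓ₀≡ℓ₂ | no ℓ₁≢ℓ₃ = ≢⇒3≤order ℓ v₁ v₀ v₃ (ℓ₀≢ℓ₁ ∘ sym) ℓ₀≢ℓ₃ ℓ₁≢ℓ₃
  where
  ℓ₀≢ℓ₁ = proper v₀ v₁ (inj₁ refl)
  ℓ₀≢ℓ₃ = λ ℓ₀≡ℓ₃ → proper v₂ v₃ (inj₁ refl) (trans (sym ℓ₀≡ℓ₂) ℓ₀≡ℓ₃)
... | yes ℓ₀≡ℓ₂ | yes ℓ₁≡ℓ₃ = ⊥-elim (alternating-not-closed (ℓ v₀) (ℓ v₁) k≢0
  (subst (λ s → s ≡ k [mod n ]) (+-identityˡ (ℓ v₀ +ℤ ℓ v₁)) (sums v₀))
  (subst (λ s → (ℓ v₀ +ℤ (ℓ v₁ +ℤ s)) ≡ k [mod n ]) (sym ℓ₀≡ℓ₂) (sums v₁))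
  (subst₂ (λ s t → (ℓ v₁ +ℤ (s +ℤ t)) ≡ k [mod n ]) (sym ℓ₀≡ℓ₂) (sym ℓ₁≡ℓ₃) (sums v₂)))
  where
  sums = closedColoring⇒closedPath ℓ closed

cycle₃ : ∀ {m} → ℤ → ℤ → ℤ → Labeling m
cycle₃ a b c zero    = a
cycle₃ a b c (suc v) = cycle₃ b c a v

cycle₃-proper : ∀ {m} {a b c : ℤ} → a ≢ b → b ≢ c → c ≢ a → Proper (suc m) (cycle₃ a b c)
cycle₃-proper a≢b b≢c c≢a = consecutive≢⇒proper _ (consecutive≢ a≢b b≢c c≢a)
  where
  consecutive≢ : ∀ {m} {a b c : ℤ} → a ≢ b → b ≢ c → c ≢ a →
                 ∀ (v : Fin m) → cycle₃ a b c (inject₁ v) ≢ cycle₃ a b c (suc v)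
  consecutive≢ a≢b b≢c c≢a zero    = a≢b
  consecutive≢ a≢b b≢c c≢a (suc v) = consecutive≢ b≢c c≢a a≢b v

cycle₃∈ : ∀ {m} (a b c : ℤ) (v : Fin m) → cycle₃ a b c v ∈ a ∷ b ∷ c ∷ []
cycle₃∈ a b c zero = here refl
cycle₃∈ a b c (suc v) with cycle₃∈ b c a v
... | here eq                = there (here eq)
... | there (here eq)        = there (there (here eq))
... | there (there (here eq)) = here eq

order-cycle₃ : ∀ {m} {a b c : ℤ} → a ≢ b → b ≢ c → c ≢ a → order (3 + m) (cycle₃ a b c) ≡ 3
order-cycle₃ {m} {a} {b} {c} a≢b b≢c c≢a =
  ≤-antisym (order≤length ℓ (cycle₃∈ a b c)) (≢⇒3≤order ℓ v₀ v₁ v₂ a≢b b≢c (c≢a ∘ sym))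
  where
  ℓ : Labeling (3 + m)
  ℓ = cycle₃ a b c

-- Shifting by three vertices leaves cycle₃ a b c, preceded by c, unchanged.
cycle₃-closed-extend : ∀ {n k m} a b c → (a +ℤ b +ℤ c) ≡ k [mod n ] →
  ClosedPath n k c (cycle₃ {suc m} a b c) → ClosedPath n k c (cycle₃ {3 + suc m} a b c)
cycle₃-closed-extend {n} {k} a b c sum≡k closed = λ where
    v₀                  → rotation (+-comm c (a +ℤ b))
    v₁                  → rotation (sym (+-assoc a b c))
    v₂                  → rotation (b+[c+a]≡a+b+c a b c)
    (suc (suc (suc v))) → closed v
  where
  rotation : ∀ {s} → s ≡ a +ℤ b +ℤ c → s ≡ k [mod n ]
  rotation s≡a+b+c = subst (λ s → s ≡ k [mod n ]) (sym s≡a+b+c) sum≡k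
  b+[c+a]≡a+b+c : ∀ a b c → b +ℤ (c +ℤ a) ≡ a +ℤ b +ℤ c
  b+[c+a]≡a+b+c = solve-∀

module _ {n : ℕ} {k : ℤ} where

  ≡k+n⇒≡k : ∀ {x} → x ≡ k +ℤ + n → x ≡ k [mod n ]
  ≡k+n⇒≡k x≡k+n = subst (λ s → s ≡ k [mod n ]) (sym x≡k+n) (+n≡[mod] k n)

  closed-P₁ : ClosedPath n k (+ 0) (cycle₃ {1} k (+ n) (+ 0))
  closed-P₁ v₀ = ≡⇒≡[mod] n (trans (+-identityˡ _) (+-identityʳ k))

  closed-P₂ : ClosedPath n k (+ 0) (cycle₃ {2} k (+ n) (+ 0))
  closed-P₂ v₀ = ≡k+n⇒≡k (+-identityˡ _)
  closed-P₂ v₁ = ≡k+n⇒≡k (cong (k +ℤ_) (+-identityʳ (+ n)))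

  closed-P₃ : ClosedPath n k (+ 0) (cycle₃ {3} (+ n) k (+ 0))
  closed-P₃ v₀ = ≡k+n⇒≡k (trans (+-identityˡ _) (+-comm (+ n) k))
  closed-P₃ v₁ = ≡k+n⇒≡k (trans (cong (+ n +ℤ_) (+-identityʳ k)) (+-comm (+ n) k))
  closed-P₃ v₂ = ≡⇒≡[mod] n (+-identityʳ k)

  closed-P₃′ : ClosedPath n k (+ 0) (cycle₃ {3} (+ 0) k (+ 0))
  closed-P₃′ v₀ = ≡⇒≡[mod] n (trans (+-identityˡ _) (+-identityˡ k))
  closed-P₃′ v₁ = ≡⇒≡[mod] n (trans (+-identityˡ _) (+-identityʳ k))
  closed-P₃′ v₂ = ≡⇒≡[mod] n (+-identityʳ k)

  cycle₃-closed : ∀ m → ClosedPath n k (+ 0) (cycle₃ {suc m} k (+ n) (+ 0))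
                     ⊎ ClosedPath n k (+ 0) (cycle₃ {suc m} (+ n) k (+ 0))
  cycle₃-closed 0 = inj₁ closed-P₁
  cycle₃-closed 1 = inj₁ closed-P₂
  cycle₃-closed 2 = inj₂ closed-P₃
  cycle₃-closed (suc (suc (suc m))) =
    Sum.map (cycle₃-closed-extend k (+ n) (+ 0) (≡k+n⇒≡k (+-identityʳ _)))
            (cycle₃-closed-extend (+ n) k (+ 0) (≡k+n⇒≡k (trans (+-identityʳ _) (+-comm (+ n) k))))
            (cycle₃-closed m)

module _ {n : ℕ} {k : ℤ} (1≤n : 1 ≤ n) (k≢0[mod] : ¬ (k ≡ + 0 [mod n ])) where

  k≢0 : k ≢ + 0
  k≢0 refl = k≢0[mod] (≡⇒≡[mod] {+ 0} n refl)

  k≢n : k ≢ + n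
  k≢n refl = k≢0[mod] (+n≡[mod] (+ 0) n)

  n≢0 : + n ≢ + 0
  n≢0 = positive⇒≢0 1≤n
    where
    positive⇒≢0 : ∀ {n} → 1 ≤ n → + n ≢ + 0
    positive⇒≢0 (s≤s _) ()

  χPath-P₂ : χPath≡ n k 2 2
  χPath-P₂ = proper-closed⇒χ≡2 ℓ (cycle₃-proper k≢n n≢0 (k≢0 ∘ sym))
               (closedPath⇒closedColoring ℓ closed-P₂) λ { v₀ → here refl ; v₁ → there (here refl) }
    where
    ℓ : Labeling 2
    ℓ = cycle₃ k (+ n) (+ 0)

  χPath-P₃ : χPath≡ n k 3 2
  χPath-P₃ = proper-closed⇒χ≡2 ℓ (consecutive≢⇒proper ℓ λ { v₀ → k≢0 ∘ sym ; v₁ → k≢0 })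
               (closedPath⇒closedColoring ℓ closed-P₃′) λ { v₀ → here refl ; v₁ → there (here refl) ; v₂ → here refl }
    where
    ℓ : Labeling 3
    ℓ = cycle₃ (+ 0) k (+ 0)

  cycle₃-χ≡3 : ∀ {m} {a b c : ℤ} → a ≢ b → b ≢ c → c ≢ a →
               ClosedPath n k (+ 0) (cycle₃ {4 + m} a b c) → χPath≡ n k (4 + m) 3
  cycle₃-χ≡3 {m} {a} {b} {c} a≢b b≢c c≢a closed =
    (cycle₃ a b c , cycle₃-proper a≢b b≢c c≢a , closedPath⇒closedColoring _ closed , order-cycle₃ {suc m} a≢b b≢c c≢a) ,
    closedColoring⇒3≤order k≢0[mod]

  χPath-P≥4 : ∀ m → 4 ≤ m → χPath≡ n k m 3
  χPath-P≥4 (suc (suc (suc (suc m)))) (s≤s (s≤s (s≤s (s≤s _)))) =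
    Sum.[ cycle₃-χ≡3 k≢n n≢0 (k≢0 ∘ sym) , cycle₃-χ≡3 (k≢n ∘ sym) k≢0 (n≢0 ∘ sym) ]′ (cycle₃-closed (3 + m))

theorem4p2 : (k : ℤ) (n : ℕ) → 1 ≤ n → ¬ (k ≡ + 0 [mod n ])
    → χPath≡ n k 2 2 × χPath≡ n k 3 2 × ((m : ℕ) → 4 ≤ m → χPath≡ n k m 3)
theorem4p2 k n 1≤n k≢0[mod] = χPath-P₂ 1≤n k≢0[mod] , χPath-P₃ 1≤n k≢0[mod] , χPath-P≥4 1≤n k≢0[mod]
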